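{- Let $S^i$ and $S^j$ be static suffixes such that $S^j$ overtakes $S^i$. Then there is exactly one occurrence of $w^{swap}$ implying the overtake between $S^j$ and $S^i$; that is, there is exactly one index $s_1$ such that either Condition 1 holds with $s_1=j+s-i$ or Condition 2 holds with $s_1=i+s-j$, where: Condition 1: $s-i\ge0$; $w^{swap}$ occurs in $S$ at $s_1$; $S^{s_1}$ is static; $S^{s_1}$ overtakes $S^s$; and $m(s,s_1)\ge s-i$. Condition 2: $s-j\ge0$; $w^{swap}$ occurs in $S$ at $s_1$; $S^{s_1}$ is static; $S^s$ overtakes $S^{s_1}$; and $m(s,s_1)\ge s-j$. Here $m(s,s_1)=\min(lcs_S(s-1,s_1-1),lcs_T(s-1,s_1-1))$.
   Context: $T[1\ldots n]$ is a string over an ordered alphabet and $S[1\ldots n]$ is obtained from $T$ by a substitution at position $x$ ($S[x]\neq T[x]$, all other symbols equal). $k\ge1$ is an integer parameter, and $w^{swap}=S[s\ldots e]$ with $s=x-k$, $e=x-1$ (so $x>k$). For a string $X$, $X^i=X[i\ldots n]$, and $lcs_X(a,b)$ is the length of the longest common suffix of $X[1\ldots a]$ and $X[1\ldots b]$. $<_L$ is lexicographic order. A suffix $S^i$ is static if $x\notin[i\ldots i+k-1]$. For static suffixes $S^i,S^j$ that are close (i.e., $S[i\ldots i+k-1]=S[j\ldots j+k-1]$), $S^j$ overtakes $S^i$ if $T^j<_L T^i$ and $S^j>_L S^i$. -}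

module Defs where

open import Level using (0ℓ)
open import Data.Nat using (ℕ; zero; suc; _+_; _∸_; _≤_; _⊓_)
open import Data.List using (List; drop; take; head)
open import Data.Maybe using (Maybe)
import Data.Maybe.Properties as MP
open import Data.Product using (_×_)
open import Relation.Binary.Core using (Rel)
open import Relation.Binary.Definitions using (DecidableEquality)
open import Relation.Binary.PropositionalEquality using (_≡_)
open import Relation.Nullary using (yes; no; ¬_)
open import Data.List.Relation.Binary.Lex.Strict using (Lex-<)

-- Strings are lists; all positions are 1-based as in the paper.
module _ {A : Set} where

  suf : List A → ℕ → List A
  suf X i = drop (i ∸ 1) X

  -- X[a..b]  (empty if b < a)
  sub : List A → ℕ → ℕ → List A
  sub X a b = take (suc b ∸ a) (drop (a ∸ 1) X)

  at : List A → ℕ → Maybe A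
  at X p = head (drop (p ∸ 1) X)

  lcs : DecidableEquality A → List A → ℕ → ℕ → ℕ
  lcs _≟_ X zero b = 0
  lcs _≟_ X (suc a) zero = 0
  lcs _≟_ X (suc a) (suc b) with MP.≡-dec _≟_ (at X (suc a)) (at X (suc b))
  ... | yes _ = suc (lcs _≟_ X a b)
  ... | no _ = 0

-- The setting: alphabet order _<_, its decidable equality, length n,
-- parameter k, substitution position x, original T and modified S.
module Setting {A : Set} (_<_ : Rel A 0ℓ) (_≟_ : DecidableEquality A)
               (n k x : ℕ) (T S : List A) where

  _<L_ : Rel (List A) 0ℓ
  _<L_ = Lex-< _≡_ _<_

  s e : ℕ
  s = x ∸ k
  e = x ∸ 1

  wswap : List A
  wswap = sub S s e

  Static : ℕ → Set
  Static i = 1 ≤ i × i ≤ n × ¬ (i ≤ x × x ≤ i + k ∸ 1)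

  Close : ℕ → ℕ → Set
  Close i j = sub S i (i + k ∸ 1) ≡ sub S j (j + k ∸ 1)

  Overtakes : ℕ → ℕ → Set
  Overtakes j i = Static i × Static j × Close i j
                × (suf T j <L suf T i) × (suf S i <L suf S j)

  OccursAt : ℕ → Set
  OccursAt p = 1 ≤ p × p + k ∸ 1 ≤ n × sub S p (p + k ∸ 1) ≡ wswap

  m : ℕ → ℕ → ℕ
  m a b = lcs _≟_ S (a ∸ 1) (b ∸ 1) ⊓ lcs _≟_ T (a ∸ 1) (b ∸ 1)

  Cond1 : ℕ → ℕ → Set
  Cond1 i s₁ = i ≤ s × OccursAt s₁ × Static s₁ × Overtakes s₁ s × s ∸ i ≤ m s s₁

  Cond2 : ℕ → ℕ → Set
  Cond2 j s₁ = j ≤ s × OccursAt s₁ × Static s₁ × Overtakes s s₁ × s ∸ j ≤ m s s₁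

-- Both length-k windows avoid x, so S and T agree on them; hence T^i and T^j must
-- agree up to the first position where one of them reads x, since any earlier
-- difference would order S^i, S^j like T^i, T^j.  Let a ∈ {i, j} be the suffix reaching
-- x first, at offset k + r, and b the other one.  Shifting both by r gives s = a + r and
-- the occurrence s₁ = b + r of w^swap: the shifted pair keeps both orders and has a
-- common suffix of length r in S and in T, which is Condition 1 (a = i) or
-- Condition 2 (a = j).  Each condition's equation pins s₁ down, and a solution of the
-- other condition would sit at s + c with c > k, its long common suffix with s then
-- aligning x with an earlier position where S and T agree, against S[x] ≠ T[x].

module Submission where

open import Defs
open import Level using (0ℓ)
open import Data.Empty using (⊥; ⊥-elim)
open import Data.List using (List; []; _∷_; length; take; drop; head)
open import Data.List.Properties using (drop-drop; drop-all)
import Data.List.Properties as List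
open import Data.List.Relation.Binary.Lex.Strict using (Lex-<; base; halt; this; next; <-asymmetric)
open import Data.Maybe using (just; nothing)
open import Data.Maybe.Properties using (just-injective)
import Data.Maybe.Properties as Maybe
open import Data.Nat hiding (_≟_)
open import Data.Nat.Properties hiding (_≟_)
open import Data.Nat.Tactic.RingSolver using (solve)
open import Data.Product using (∃!; _×_; _,_; proj₁; proj₂)
open import Data.Sum using (_⊎_; inj₁; inj₂; [_,_]′)
open import Function using (_∘_)
open import Relation.Binary.Core using (Rel)
open import Relation.Binary.Definitions using (DecidableEquality; tri<; tri≈; tri>)
open import Relation.Binary.Structures using (IsStrictTotalOrder)
open import Relation.Binary.PropositionalEquality
open import Relation.Nullary using (¬_; yes; no)

open ≡-Reasoning

≤pred⇒< : ∀ {m n} → 1 ≤ n → m ≤ pred n → m < n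
≤pred⇒< {n = suc n} _ m≤n = s≤s m≤n

pred<⇒≤ : ∀ {m n} → 1 ≤ m → pred m < n → m ≤ n
pred<⇒≤ {m = suc m} _ m<n = m<n

m≤pred[m+n] : ∀ m {n} → 1 ≤ n → m ≤ pred (m + n)
m≤pred[m+n] m 1≤n = subst (m ≤_) (sym (+-∸-assoc m 1≤n)) (m≤m+n m _)

module _ {A : Set} where

  Agree : List A → ℕ → ℕ → ℕ → Set
  Agree X a b q = ∀ u → u < q → at X (a + u) ≡ at X (b + u)

  Agree-sym : ∀ {X a b q} → Agree X a b q → Agree X b a q
  Agree-sym h u u<q = sym (h u u<q)

  Agree-mono : ∀ {X a b q r} → r ≤ q → Agree X a b q → Agree X a b r
  Agree-mono r≤q h u u<r = h u (<-≤-trans u<r r≤q)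

  Agree-shift : ∀ {X a b} r q → Agree X a b (r + q) → Agree X (a + r) (b + r) q
  Agree-shift {a = a} {b} r q h u u<q
    rewrite +-assoc a r u | +-assoc b r u = h (r + u) (+-monoʳ-< r u<q)

  at-suf : ∀ (X : List A) a u → 1 ≤ a → at X (a + u) ≡ head (drop u (suf X a))
  at-suf X (suc a) u _ = cong head (sym (drop-drop a u X))

  suf-+ : ∀ (X : List A) a r → 1 ≤ a → suf X (a + r) ≡ drop r (suf X a)
  suf-+ X (suc a) r _ = sym (drop-drop a r X)

  sub-as-take : ∀ (X : List A) a l → 1 ≤ a → sub X a (pred (a + l)) ≡ take l (suf X a)
  sub-as-take X (suc a) l _ = cong (λ z → take z (drop a X)) (m+n∸m≡n a l)

  at-beyond-length : ∀ (X : List A) p → length X < p → at X p ≡ nothing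
  at-beyond-length X p |X|<p = cong head (drop-all (pred p) X (<⇒≤pred |X|<p))

  at-defined⇒≤length : ∀ (X : List A) p → at X p ≢ nothing → p ≤ length X
  at-defined⇒≤length X p defined = ≮⇒≥ (defined ∘ at-beyond-length X p)

  at-within-length : ∀ (X : List A) p → 1 ≤ p → p ≤ length X → at X p ≢ nothing
  at-within-length (_ ∷ X) (suc zero) _ _ ()
  at-within-length (_ ∷ X) (suc (suc p)) _ (s≤s p≤|X|) = at-within-length X (suc p) (s≤s z≤n) p≤|X|

  take-≡⁺ : ∀ q (P Q : List A) → (∀ u → u < q → head (drop u P) ≡ head (drop u Q)) →
            take q P ≡ take q Q
  take-≡⁺ zero P Q h = refl
  take-≡⁺ (suc q) [] [] h = refl
  take-≡⁺ (suc q) [] (_ ∷ _) h with h 0 z<s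
  ... | ()
  take-≡⁺ (suc q) (_ ∷ _) [] h with h 0 z<s
  ... | ()
  take-≡⁺ (suc q) (_ ∷ P) (_ ∷ Q) h =
    cong₂ _∷_ (just-injective (h 0 z<s)) (take-≡⁺ q P Q (λ u u<q → h (suc u) (s<s u<q)))

  take-≡⁻ : ∀ q (P Q : List A) → take q P ≡ take q Q →
            ∀ u → u < q → head (drop u P) ≡ head (drop u Q)
  take-≡⁻ (suc q) [] [] eq u u<q = refl
  take-≡⁻ (suc q) (p ∷ P) (p′ ∷ Q) eq zero u<q = cong just (proj₁ (List.∷-injective eq))
  take-≡⁻ (suc q) (p ∷ P) (p′ ∷ Q) eq (suc u) (s≤s u<q) = take-≡⁻ q P Q (proj₂ (List.∷-injective eq)) u u<q

  ≡-from-heads : ∀ (P Q : List A) → (∀ u → head (drop u P) ≡ head (drop u Q)) → P ≡ Q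
  ≡-from-heads [] [] h = refl
  ≡-from-heads [] (_ ∷ _) h with h 0
  ... | ()
  ≡-from-heads (_ ∷ _) [] h with h 0
  ... | ()
  ≡-from-heads (_ ∷ P) (_ ∷ Q) h = cong₂ _∷_ (just-injective (h 0)) (≡-from-heads P Q (h ∘ suc))

  Agree⇒take≡ : ∀ (X : List A) a b q → 1 ≤ a → 1 ≤ b → Agree X a b q →
                take q (suf X a) ≡ take q (suf X b)
  Agree⇒take≡ X a b q 1≤a 1≤b h = take-≡⁺ q _ _ λ u u<q →
    trans (sym (at-suf X a u 1≤a)) (trans (h u u<q) (at-suf X b u 1≤b))

  take≡⇒Agree : ∀ (X : List A) a b q → 1 ≤ a → 1 ≤ b →
                take q (suf X a) ≡ take q (suf X b) → Agree X a b q
  take≡⇒Agree X a b q 1≤a 1≤b eq u u<q =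
    trans (at-suf X a u 1≤a) (trans (take-≡⁻ q _ _ eq u u<q) (sym (at-suf X b u 1≤b)))

module _ {A : Set} {_≺_ : Rel A 0ℓ} where

  private
    _<L_ : Rel (List A) 0ℓ
    _<L_ = Lex-< _≡_ _≺_

  <L-drop-common-prefix : (∀ {a} → ¬ a ≺ a) → ∀ t (P Q : List A) →
                          take t P ≡ take t Q → P <L Q → drop t P <L drop t Q
  <L-drop-common-prefix irr zero P Q eq lt = lt
  <L-drop-common-prefix irr (suc t) [] [] eq (base ())
  <L-drop-common-prefix irr (suc t) (p ∷ P) (q ∷ Q) eq (this p≺q)
    with refl ← proj₁ (List.∷-injective eq) = ⊥-elim (irr p≺q)
  <L-drop-common-prefix irr (suc t) (p ∷ P) (q ∷ Q) eq (next _ lt) =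
    <L-drop-common-prefix irr t P Q (proj₂ (List.∷-injective eq)) lt

  <L-from-distinct-prefixes : ∀ t (U V U′ V′ : List A) →
    take t U ≡ take t U′ → take t V ≡ take t V′ → take t U ≢ take t V → V <L U → V′ <L U′
  <L-from-distinct-prefixes zero U V U′ V′ eqU eqV neq lt = ⊥-elim (neq refl)
  <L-from-distinct-prefixes (suc t) [] V U′ V′ eqU eqV neq (base ())
  <L-from-distinct-prefixes (suc t) (u ∷ U) [] (u′ ∷ U′) [] eqU eqV neq lt = halt
  <L-from-distinct-prefixes (suc t) (u ∷ U) (v ∷ V) (u′ ∷ U′) (v′ ∷ V′) eqU eqV neq lt
    with refl , eqU′ ← List.∷-injective eqU | refl , eqV′ ← List.∷-injective eqV | lt
  ... | this v≺u = this v≺u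
  ... | next refl lt′ =
    next refl (<L-from-distinct-prefixes t U V U′ V′ eqU′ eqV′ (neq ∘ cong (u ∷_)) lt′)

module _ {A : Set} (_≟_ : DecidableEquality A) where

  lcs-at≡ : ∀ (X : List A) t p q → t < lcs _≟_ X (t + p) (t + q) → at X p ≡ at X q
  lcs-at≡ X zero (suc p) (suc q) lt with Maybe.≡-dec _≟_ (at X (suc p)) (at X (suc q))
  lcs-at≡ X zero (suc p) (suc q) lt | yes eq = eq
  lcs-at≡ X zero (suc p) (suc q) () | no _
  lcs-at≡ X (suc t) p q lt with Maybe.≡-dec _≟_ (at X (suc (t + p))) (at X (suc (t + q)))
  lcs-at≡ X (suc t) p q (s≤s lt) | yes _ = lcs-at≡ X t p q lt
  lcs-at≡ X (suc t) p q () | no _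

  Agree⇒≤lcs : ∀ (X : List A) a b r → 1 ≤ a → 1 ≤ b → Agree X a b r →
               r ≤ lcs _≟_ X (pred (a + r)) (pred (b + r))
  Agree⇒≤lcs X (suc a) (suc b) zero _ _ _ = z≤n
  Agree⇒≤lcs X (suc a) (suc b) (suc r) 1≤a 1≤b h rewrite +-suc a r | +-suc b r
    with Maybe.≡-dec _≟_ (at X (suc (a + r))) (at X (suc (b + r)))
  ... | yes _ = s≤s (Agree⇒≤lcs X (suc a) (suc b) r 1≤a 1≤b (Agree-mono {X = X} {suc a} {suc b} (n≤1+n r) h))
  ... | no neq = ⊥-elim (neq (h r ≤-refl))

module Development {A : Set} (_≺_ : Rel A 0ℓ) (sto : IsStrictTotalOrder _≡_ _≺_)
  (n k x : ℕ) (T S : List A) (|T|≡n : length T ≡ n) (|S|≡n : length S ≡ n)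
  (1≤k : 1 ≤ k) (k<x : k < x) (x≤n : x ≤ n)
  (Sx≢Tx : at S x ≢ at T x)
  (S≡T : ∀ p → 1 ≤ p → p ≤ n → p ≢ x → at S p ≡ at T p) where

  open IsStrictTotalOrder sto using (irrefl; asym; <-resp-≈; _≟_)
  open Setting _≺_ _≟_ n k x T S

  <L-asym : ∀ {P Q} → P <L Q → ¬ Q <L P
  <L-asym = <-asymmetric sym <-resp-≈ asym

  <L-shift : ∀ X c d r → 1 ≤ c → 1 ≤ d → Agree X c d r →
             suf X c <L suf X d → suf X (c + r) <L suf X (d + r)
  <L-shift X c d r 1≤c 1≤d h lt =
    subst₂ _<L_ (sym (suf-+ X c r 1≤c)) (sym (suf-+ X d r 1≤d))
      (<L-drop-common-prefix (irrefl refl) r _ _ (Agree⇒take≡ X c d r 1≤c 1≤d h) lt)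

  at-S≡T : ∀ p → 1 ≤ p → p ≢ x → at S p ≡ at T p
  at-S≡T p 1≤p p≢x with p ≤? n
  ... | yes p≤n = S≡T p 1≤p p≤n p≢x
  ... | no p≰n = trans (undefined S |S|≡n) (sym (undefined T |T|≡n))
    where
    undefined : ∀ X → length X ≡ n → at X p ≡ nothing
    undefined X |X|≡n = at-beyond-length X p (subst (_< p) (sym |X|≡n) (≰⇒> p≰n))

  heads-S≡T : ∀ a u → 1 ≤ a → a + u ≢ x → head (drop u (suf S a)) ≡ head (drop u (suf T a))
  heads-S≡T a u 1≤a a+u≢x = begin
    head (drop u (suf S a)) ≡⟨ at-suf S a u 1≤a ⟨
    at S (a + u)            ≡⟨ at-S≡T (a + u) (≤-trans 1≤a (m≤m+n a u)) a+u≢x ⟩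
    at T (a + u)            ≡⟨ at-suf T a u 1≤a ⟩
    head (drop u (suf T a)) ∎

  AvoidsX : ℕ → ℕ → Set
  AvoidsX a q = ∀ u → u < q → a + u ≢ x

  window-S≡T : ∀ a q → 1 ≤ a → AvoidsX a q → take q (suf S a) ≡ take q (suf T a)
  window-S≡T a q 1≤a avoids = take-≡⁺ q _ _ λ u u<q → heads-S≡T a u 1≤a (avoids u u<q)

  suf-S≡T-past-x : ∀ a → x < a → suf S a ≡ suf T a
  suf-S≡T-past-x a x<a = ≡-from-heads _ _ λ u →
    heads-S≡T a u (≤-trans (s≤s z≤n) x<a) (>⇒≢ (<-≤-trans x<a (m≤m+n a u)))

  -- A difference of the T-windows would order S^i, S^j like T^i, T^j.
  overtake⇒Agree-T : ∀ {i j} q → Overtakes j i → AvoidsX i q → AvoidsX j q → Agree T i j q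
  overtake⇒Agree-T {i} {j} q ((1≤i , _) , (1≤j , _) , _ , Tj<Ti , Si<Sj) avoidsᵢ avoidsⱼ =
    take≡⇒Agree T i j q 1≤i 1≤j T-windows-equal
    where
    T-windows-equal : take q (suf T i) ≡ take q (suf T j)
    T-windows-equal with List.≡-dec _≟_ (take q (suf T i)) (take q (suf T j))
    ... | yes eq = eq
    ... | no neq = ⊥-elim (<L-asym Si<Sj
            (<L-from-distinct-prefixes q (suf T i) (suf T j) (suf S i) (suf S j)
              (sym (window-S≡T i q 1≤i avoidsᵢ)) (sym (window-S≡T j q 1≤j avoidsⱼ)) neq Tj<Ti))

  s+k≡x : s + k ≡ x
  s+k≡x = m∸n+n≡m (<⇒≤ k<x)

  static-s : Static s
  static-s = m<n⇒0<n∸m k<x , ≤-trans (m∸n≤m x k) x≤n , λ (_ , x≤s+k∸1) →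
    <-irrefl refl (≤pred⇒< (≤-trans (s≤s z≤n) k<x) (subst (λ z → x ≤ pred z) s+k≡x x≤s+k∸1))

  -- A common suffix of length c > k ending before s and before s + c aligns x = s + k
  -- with the position s + k ∸ c < x, where S and T agree.
  no-lcs-across-x : ∀ c → k < c → c ≤ s → c ≤ m s (s + c) → ⊥
  no-lcs-across-x c k<c c≤s c≤m with m≤n⇒∃[o]m+o≡n k<c | m≤n⇒∃[o]m+o≡n c≤s
  ... | e , refl | w , c+w≡s = Sx≢Tx (begin
    at S x ≡⟨ aligned S (≤-trans c≤m (m⊓n≤m _ _)) ⟨
    at S p ≡⟨ at-S≡T p (≤-trans 1≤k (m≤m+n k w)) (<⇒≢ p<x) ⟩
    at T p ≡⟨ aligned T (≤-trans c≤m (m⊓n≤n _ _)) ⟩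
    at T x ∎)
    where
    p = k + w

    s∸1≡e+p : pred s ≡ e + p
    s∸1≡e+p = begin
      pred s      ≡⟨ cong pred c+w≡s ⟨
      k + e + w   ≡⟨ solve (k ∷ e ∷ w ∷ []) ⟩
      e + (k + w) ∎

    s+c∸1≡e+x : pred (s + suc (k + e)) ≡ e + x
    s+c∸1≡e+x = begin
      pred (s + suc (k + e)) ≡⟨ cong pred (+-suc s (k + e)) ⟩
      s + (k + e)            ≡⟨ +-assoc s k e ⟨
      s + k + e              ≡⟨ +-comm (s + k) e ⟩
      e + (s + k)            ≡⟨ cong (e +_) s+k≡x ⟩
      e + x                  ∎

    aligned : ∀ X → suc (k + e) ≤ lcs _≟_ X (pred s) (pred (s + suc (k + e))) → at X p ≡ at X x
    aligned X c≤lcs = lcs-at≡ _≟_ X e p x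
      (subst₂ (λ a b → e < lcs _≟_ X a b) s∸1≡e+p s+c∸1≡e+x (<-≤-trans (s≤s (m≤n+m e k)) c≤lcs))

    p<x : p < x
    p<x = subst (p <_) (trans (+-comm k s) s+k≡x)
            (+-monoʳ-< k (subst (w <_) c+w≡s (s≤s (m≤n+m w (k + e)))))

  no-witness-right-of-s : ∀ a b y → b < a → a ≤ s → y + b ≡ a + s → Static y → s ∸ b ≤ m s y → ⊥
  no-witness-right-of-s a b y b<a a≤s y+b≡a+s (_ , _ , y-static) s∸b≤m
    with m≤n⇒∃[o]m+o≡n (<⇒≤ b<a)
  ... | c , refl = no-lcs-across-x c k<c (≤-trans (m≤n+m c b) a≤s)
                     (≤-trans c≤s∸b (subst (λ z → s ∸ b ≤ m s z) y≡s+c s∸b≤m))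
    where
    y≡s+c : y ≡ s + c
    y≡s+c = +-cancelʳ-≡ b y (s + c) (begin
      y + b       ≡⟨ y+b≡a+s ⟩
      b + c + s   ≡⟨ +-comm (b + c) s ⟩
      s + (b + c) ≡⟨ cong (s +_) (+-comm b c) ⟩
      s + (c + b) ≡⟨ +-assoc s c b ⟨
      s + c + b   ∎)

    0<c : 0 < c
    0<c = +-cancelˡ-< b 0 c (subst (_< b + c) (sym (+-identityʳ b)) b<a)

    k<c : k < c
    k<c = ≰⇒> λ c≤k → y-static
      ( subst₂ _≤_ (sym y≡s+c) s+k≡x (+-monoʳ-≤ s c≤k)
      , subst₂ (λ u v → u ≤ pred (v + k)) s+k≡x (sym y≡s+c) (<⇒≤pred (+-monoˡ-< k (m<m+n s 0<c))))

    c≤s∸b : c ≤ s ∸ b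
    c≤s∸b = m+n≤o⇒m≤o∸n c (subst (_≤ s) (+-comm b c) a≤s)

  -- The window of a runs into x no later than the window of b.
  Leads : ℕ → ℕ → Set
  Leads a b = a ≤ x × (b ≤ x → b < a)

  leader : ∀ {i j} → Static i → Static j → Overtakes j i → Leads i j ⊎ Leads j i
  leader {i} {j} _ _ (_ , _ , _ , Tj<Ti , Si<Sj) with i ≤? x | j ≤? x
  ... | yes i≤x | no j≰x = inj₁ (i≤x , ⊥-elim ∘ j≰x)
  ... | no i≰x | yes j≤x = inj₂ (j≤x , ⊥-elim ∘ i≰x)
  ... | no i≰x | no j≰x =
    ⊥-elim (<L-asym Tj<Ti (subst₂ _<L_ (past-x i≰x) (past-x j≰x) Si<Sj))
    where
    past-x : ∀ {a} → a ≰ x → suf S a ≡ suf T a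
    past-x a≰x = suf-S≡T-past-x _ (≰⇒> a≰x)
  ... | yes i≤x | yes j≤x with <-cmp i j
  ...   | tri< i<j _ _ = inj₂ (j≤x , λ _ → i<j)
  ...   | tri≈ _ refl _ = ⊥-elim (<L-asym Tj<Ti Tj<Ti)
  ...   | tri> _ _ j<i = inj₁ (i≤x , λ _ → j<i)

  module Witness (a b : ℕ) (sta : Static a) (stb : Static b) (a-leads : Leads a b)
                 (agree-T : ∀ q → AvoidsX a q → AvoidsX b q → Agree T a b q) where

    private
      1≤a = proj₁ sta
      1≤b = proj₁ stb

    r : ℕ
    r = s ∸ a

    a≤s : a ≤ s
    a≤s = m+n≤o⇒m≤o∸n a (pred<⇒≤ (≤-trans 1≤k (m≤n+m k a))
            (≰⇒> λ x≤a+k∸1 → proj₂ (proj₂ sta) (proj₁ a-leads , x≤a+k∸1)))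

    a+r≡s : a + r ≡ s
    a+r≡s = m+[n∸m]≡n a≤s

    before-x : ∀ u → u < k + r → a + u < x
    before-x u u<k+r = subst (a + u <_) a+[k+r]≡x (+-monoʳ-< a u<k+r)
      where
      a+[k+r]≡x : a + (k + r) ≡ x
      a+[k+r]≡x = begin
        a + (k + r) ≡⟨ cong (a +_) (+-comm k r) ⟩
        a + (r + k) ≡⟨ +-assoc a r k ⟨
        a + r + k   ≡⟨ cong (_+ k) a+r≡s ⟩
        s + k       ≡⟨ s+k≡x ⟩
        x           ∎

    avoids-a : AvoidsX a (k + r)
    avoids-a u u<k+r = <⇒≢ (before-x u u<k+r)

    avoids-b : AvoidsX b (k + r)
    avoids-b u u<k+r b+u≡x = <-irrefl b+u≡x
      (<-trans (+-monoˡ-< u (proj₂ a-leads (subst (b ≤_) b+u≡x (m≤m+n b u)))) (before-x u u<k+r))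

    agreeT : Agree T a b (k + r)
    agreeT = agree-T (k + r) avoids-a avoids-b

    agreeS : Agree S a b (k + r)
    agreeS u u<k+r = begin
      at S (a + u) ≡⟨ at-S≡T (a + u) (≤-trans 1≤a (m≤m+n a u)) (avoids-a u u<k+r) ⟩
      at T (a + u) ≡⟨ agreeT u u<k+r ⟩
      at T (b + u) ≡⟨ at-S≡T (b + u) (≤-trans 1≤b (m≤m+n b u)) (avoids-b u u<k+r) ⟨
      at S (b + u) ∎

    1≤b+r : 1 ≤ b + r
    1≤b+r = ≤-trans 1≤b (m≤m+n b r)

    close : Close s (b + r)
    close = begin
      sub S s (pred (s + k))               ≡⟨ sub-as-take S s k (proj₁ static-s) ⟩
      take k (suf S s)                     ≡⟨ cong (λ z → take k (suf S z)) a+r≡s ⟨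
      take k (suf S (a + r))               ≡⟨ Agree⇒take≡ S (a + r) (b + r) k
                                                (≤-trans 1≤a (m≤m+n a r)) 1≤b+r
                                                (Agree-shift {X = S} {a} {b} r k (subst (Agree S a b) (+-comm k r) agreeS)) ⟩
      take k (suf S (b + r))               ≡⟨ sub-as-take S (b + r) k 1≤b+r ⟨
      sub S (b + r) (pred (b + r + k))     ∎

    -- The T-windows agree, and the one of a lies inside T, so the one of b does too.
    window-end≤n : pred (b + r + k) ≤ n
    window-end≤n = subst₂ _≤_ b+u≡end |T|≡n (at-defined⇒≤length T (b + u) (λ undefined →
      at-within-length T (a + u) (≤-trans 1≤a (m≤m+n a u))
        (subst (a + u ≤_) (sym |T|≡n) (≤-trans (<⇒≤ (before-x u u<k+r)) x≤n))
        (trans (agreeT u u<k+r) undefined)))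
      where
      u = r + pred k
      u<k+r : u < k + r
      u<k+r = subst (u <_) (+-comm r k) (+-monoʳ-< r (≤pred⇒< 1≤k ≤-refl))
      b+u≡end : b + u ≡ pred (b + r + k)
      b+u≡end = sym (trans (+-∸-assoc (b + r) 1≤k) (+-assoc b r (pred k)))

    occurs : OccursAt (b + r)
    occurs = 1≤b+r , window-end≤n , trans (sym close) (cong (sub S s ∘ pred) s+k≡x)

    static-b+r : Static (b + r)
    static-b+r = 1≤b+r , ≤-trans (m≤pred[m+n] (b + r) 1≤k) window-end≤n , λ (b+r≤x , x≤end) →
      let b≤x = ≤-trans (m≤m+n b r) b+r≤x
          b+[x∸b]≡x = m+[n∸m]≡n b≤x
      in avoids-b (x ∸ b) (+-cancelˡ-< b (x ∸ b) (k + r)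
           (subst₂ _<_ (sym b+[x∸b]≡x) (trans (+-assoc b r k) (cong (b +_) (+-comm r k)))
             (≤pred⇒< (≤-trans 1≤k (m≤n+m k (b + r))) x≤end)))
           b+[x∸b]≡x

    prefix-agrees : ∀ {X : List A} → Agree X a b (k + r) → Agree X a b r
    prefix-agrees {X} = Agree-mono {X = X} {a} {b} (m≤n+m r k)

    lcs-bound : r ≤ m s (b + r)
    lcs-bound = subst (λ z → r ≤ m z (b + r)) a+r≡s
      (⊓-glb (Agree⇒≤lcs _≟_ S a b r 1≤a 1≤b (prefix-agrees agreeS))
             (Agree⇒≤lcs _≟_ T a b r 1≤a 1≤b (prefix-agrees agreeT)))

    shift-forward : ∀ X → Agree X a b (k + r) → suf X a <L suf X b → suf X s <L suf X (b + r)
    shift-forward X h lt = subst (λ z → suf X z <L suf X (b + r)) a+r≡s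
      (<L-shift X a b r 1≤a 1≤b (prefix-agrees h) lt)

    shift-backward : ∀ X → Agree X a b (k + r) → suf X b <L suf X a → suf X (b + r) <L suf X s
    shift-backward X h lt = subst (λ z → suf X (b + r) <L suf X z) a+r≡s
      (<L-shift X b a r 1≤b 1≤a (Agree-sym {X = X} {a} {b} (prefix-agrees h)) lt)

    solves-equation : b + r + a ≡ b + s
    solves-equation = trans (+-assoc b r a) (cong (b +_) (trans (+-comm r a) a+r≡s))

    solution-unique : ∀ {y} → y + a ≡ b + s → b + r ≡ y
    solution-unique eq = +-cancelʳ-≡ a (b + r) _ (trans solves-equation (sym eq))

    no-swapped-solution : ∀ {y} → Static y → y + b ≡ a + s → b ≤ s → s ∸ b ≤ m s y → ⊥
    no-swapped-solution sty eq b≤s bound =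
      no-witness-right-of-s a b _ (proj₂ a-leads (≤-trans b≤s (m∸n≤m x k))) a≤s eq sty bound

  Witnesses : ℕ → ℕ → ℕ → Set
  Witnesses i j s₁ = (Cond1 i s₁ × s₁ + i ≡ j + s) ⊎ (Cond2 j s₁ × s₁ + j ≡ i + s)

  unique-if-i-leads : ∀ {i j} → Static i → Static j → Overtakes j i → Leads i j →
                      ∃! _≡_ (Witnesses i j)
  unique-if-i-leads {i} {j} sti stj ov@(_ , _ , _ , Tj<Ti , Si<Sj) i-leads =
    _ , inj₁ (cond1 , solves-equation) , unique
    where
    open Witness i j sti stj i-leads (λ q → overtake⇒Agree-T q ov)
    cond1 = a≤s , occurs , static-b+r
          , (static-s , static-b+r , close , shift-backward T agreeT Tj<Ti , shift-forward S agreeS Si<Sj)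
          , lcs-bound
    unique : ∀ {y} → Witnesses i j y → _ ≡ y
    unique (inj₁ (_ , eq)) = solution-unique eq
    unique (inj₂ ((j≤s , _ , sty , _ , bound) , eq)) = ⊥-elim (no-swapped-solution sty eq j≤s bound)

  unique-if-j-leads : ∀ {i j} → Static i → Static j → Overtakes j i → Leads j i →
                      ∃! _≡_ (Witnesses i j)
  unique-if-j-leads {i} {j} sti stj ov@(_ , _ , _ , Tj<Ti , Si<Sj) j-leads =
    _ , inj₂ (cond2 , solves-equation) , unique
    where
    open Witness j i stj sti j-leads
      (λ q avoidsⱼ avoidsᵢ → Agree-sym {X = T} {a = i} {b = j} (overtake⇒Agree-T q ov avoidsᵢ avoidsⱼ))
    cond2 = a≤s , occurs , static-b+r
          , (static-b+r , static-s , sym close , shift-forward T agreeT Tj<Ti , shift-backward S agreeS Si<Sj)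
          , lcs-bound
    unique : ∀ {y} → Witnesses i j y → _ ≡ y
    unique (inj₂ (_ , eq)) = solution-unique eq
    unique (inj₁ ((i≤s , _ , sty , _ , bound) , eq)) = ⊥-elim (no-swapped-solution sty eq i≤s bound)

mainTheorem13 : {A : Set} (_≺_ : Rel A 0ℓ) (sto : IsStrictTotalOrder _≡_ _≺_)
    (n k x : ℕ) (T S : List A) →
    length T ≡ n → length S ≡ n →
    1 ≤ k → k < x → x ≤ n →
    at S x ≢ at T x →
    (∀ p → 1 ≤ p → p ≤ n → p ≢ x → at S p ≡ at T p) →
    (i j : ℕ) →
    Setting.Static _≺_ (IsStrictTotalOrder._≟_ sto) n k x T S i →
    Setting.Static _≺_ (IsStrictTotalOrder._≟_ sto) n k x T S j →
    Setting.Overtakes _≺_ (IsStrictTotalOrder._≟_ sto) n k x T S j i →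
    ∃! _≡_ (λ s₁ →
      (Setting.Cond1 _≺_ (IsStrictTotalOrder._≟_ sto) n k x T S i s₁
        × s₁ + i ≡ j + Setting.s _≺_ (IsStrictTotalOrder._≟_ sto) n k x T S)
      ⊎ (Setting.Cond2 _≺_ (IsStrictTotalOrder._≟_ sto) n k x T S j s₁
        × s₁ + j ≡ i + Setting.s _≺_ (IsStrictTotalOrder._≟_ sto) n k x T S))
mainTheorem13 _≺_ sto n k x T S |T|≡n |S|≡n 1≤k k<x x≤n Sx≢Tx S≡T i j sti stj ov =
  [ unique-if-i-leads sti stj ov , unique-if-j-leads sti stj ov ]′ (leader sti stj ov)
  where open Development _≺_ sto n k x T S |T|≡n |S|≡n 1≤k k<x x≤n Sx≢Tx S≡T
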